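{- Let $B=\{1342,1432\}$. Then $\mathcal{G}(12)=\{(g_1,g_2,g_3)\in\mathbb{N}^3 : g_2\le 1\}$ (that is, the basis of $\mathcal{G}(12)$ is the single vector $(0,2,0)$), and the entry $2$ of the permutation $12$ is ES$^+$-reducible with respect to $B$; i.e. for every gap vector $(g_1,g_2,g_3)$ with $g_2\le 1$, removing the entry $2$ and standardizing gives a bijection from $Z(B;12;(g_1,g_2,g_3))$ onto $Z(B;1;(g_1,g_2+g_3))$.
   Context: For a set of permutations $B$, $\operatorname{Av}(B)$ is the set of permutations avoiding every element of $B$. For a permutation $\pi$ of length $k$ and a gap vector ${\bf g}=(g_1,\dots,g_{k+1})\in\mathbb{N}^{k+1}$, $Z(B;\pi;{\bf g})$ is the set of $B$-avoiding permutations $p$ of length $k+g_1+\cdots+g_{k+1}$ such that $p(g_1+1)=\pi(1)$, $p(g_1+g_2+2)=\pi(2)$, $\dots$, $p(g_1+\cdots+g_k+k)=\pi(k)$; i.e. the $k$ smallest entries form a copy of $\pi$ with $g_i$ further entries in the $i$-th gap. $\mathcal{G}(\pi)=\{{\bf g} : Z(B;\pi;{\bf g})\neq\emptyset\}$, a lower order ideal of $\mathbb{N}^{k+1}$ under the product order; its basis is the set of minimal vectors not in it. For $r\in[k]$, $d_r(\pi)$ is the standardization of $\pi$ with the entry $\pi(r)$ removed, and $d_r({\bf g})=(g_1,\dots,g_{r-1},g_r+g_{r+1},g_{r+2},\dots,g_{k+1})$. The entry $\pi(r)$ is ES$^+$-reducible if $|Z(B;\pi;{\bf g})|=|Z(B;d_r(\pi);d_r({\bf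 g}))|$ whenever $Z(B;\pi;{\bf g})$ is nonempty (removing $\pi(r)$ and standardizing gives a natural injection of the former set into the latter). -}

module Defs where

open import Data.Nat using (ℕ; zero; suc; _+_; _<?_; _≟_)
open import Data.List using (List; []; _∷_; _++_; map; filter; length; upTo)
open import Data.List.Membership.Propositional using (_∈_)
open import Data.List.Relation.Binary.Permutation.Propositional using (_↭_)
open import Data.List.Relation.Binary.Sublist.Propositional using (_⊆_)
open import Data.Product using (Σ; ∃; _×_)
open import Data.Empty using (⊥)
open import Relation.Nullary using (¬_; ¬?)
open import Relation.Binary.PropositionalEquality using (_≡_)

-- Permutations are lists of naturals, written in one-line notation with
-- values 1..n (so the permutation 12 is 1 ∷ 2 ∷ []).
IsPerm : List ℕ → Set
IsPerm p = p ↭ map suc (upTo (length p))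

-- Standardization: replace each entry x by 1 + (number of entries < x).
-- (For lists of distinct entries this is the usual standardization.)
st : List ℕ → List ℕ
st s = map (λ x → suc (length (filter (_<? x) s))) s

Contains : List ℕ → List ℕ → Set
Contains σ p = Σ (List ℕ) (λ s → (s ⊆ p) × (st s ≡ σ))

Avoids : List (List ℕ) → List ℕ → Set
Avoids B p = ∀ σ → σ ∈ B → ¬ Contains σ p

-- Fits π g p : p = (g₁ entries) π(1) (g₂ entries) π(2) ... π(k) (g_{k+1} entries),
-- i.e. p(g₁+⋯+g_i+i) = π(i) for all i and length p = k + g₁ + ⋯ + g_{k+1}.
-- (requires length g = length π + 1; otherwise Fits is empty)
Fits : List ℕ → List ℕ → List ℕ → Set
Fits [] (g ∷ []) p = length p ≡ g
Fits [] _ p = ⊥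
Fits (x ∷ π) [] p = ⊥
Fits (x ∷ π) (g ∷ gs) p =
  Σ (List ℕ) λ l → Σ (List ℕ) λ r → (p ≡ l ++ (x ∷ r)) × (length l ≡ g) × Fits π gs r

Z : List (List ℕ) → List ℕ → List ℕ → List ℕ → Set
Z B π g p = IsPerm p × Avoids B p × Fits π g p

Nonempty : (List ℕ → Set) → Set
Nonempty P = ∃ λ p → P p

-- 1-based helpers
nth : ℕ → List ℕ → ℕ
nth _ [] = 0
nth (suc zero) (x ∷ xs) = x
nth (suc (suc r)) (x ∷ xs) = nth (suc r) xs
nth zero (x ∷ xs) = 0

deleteAt : ℕ → List ℕ → List ℕ
deleteAt _ [] = []
deleteAt zero xs = xs
deleteAt (suc zero) (x ∷ xs) = xs
deleteAt (suc (suc r)) (x ∷ xs) = x ∷ deleteAt (suc r) xs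

dPerm : ℕ → List ℕ → List ℕ
dPerm r π = st (deleteAt r π)

dGap : ℕ → List ℕ → List ℕ
dGap (suc zero) (a ∷ b ∷ gs) = (a + b) ∷ gs
dGap (suc (suc r)) (a ∷ gs) = a ∷ dGap (suc r) gs
dGap _ gs = gs

removeEntry : ℕ → List ℕ → List ℕ
removeEntry v p = st (filter (λ x → ¬? (x ≟ v)) p)

BijectionOn : (List ℕ → Set) → (List ℕ → Set) → (List ℕ → List ℕ) → Set
BijectionOn P Q f =
  (∀ p → P p → Q (f p)) ×
  (∀ p p' → P p → P p' → f p ≡ f p' → p ≡ p') ×
  (∀ q → Q q → ∃ λ p → P p × (f p ≡ q))

ESPlusReducible : List (List ℕ) → List ℕ → ℕ → Set
ESPlusReducible B π r =
  ∀ g → length g ≡ suc (length π) → Nonempty (Z B π g) →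
    BijectionOn (Z B π g) (Z B (dPerm r π) (dGap r g)) (removeEntry (nth r π))

B₀ : List (List ℕ)
B₀ = (1 ∷ 3 ∷ 4 ∷ 2 ∷ []) ∷ (1 ∷ 4 ∷ 3 ∷ 2 ∷ []) ∷ []

-- A copy of 1342 or 1432 is a subsequence a b c d with a < d < b, c and b ≠ c.  Write
-- p ∈ Z(B;12;g) as l 1 m 2 r.  If m has two entries x, y then 1 x y 2 is such a copy, so
-- g₂ ≤ 1.  Deleting 2 and standardising preserves relative order, so it maps Z(B;12;g) into
-- Z(B;1;d₂ g); it is injective because standardisation is injective on rearrangements of a
-- fixed set and the position of 2 is fixed by g.  Conversely, for q = l 1 m r with |m| ≤ 1,
-- relabel q to skip the value 2 and put 2 back right after m.  A copy of 1342 or 1432 in the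
-- result cannot have 2 as an inner entry (that would force 1 ≤ a < d < 2), a leading 2 can
-- be traded for the earlier 1, and a final 2 would need two entries between 1 and 2; so
-- every copy avoids 2 and comes from a copy in q.

module Submission where

open import Defs
open import Data.Nat using (ℕ; zero; suc; _+_; _≤_; _<_; _<?_; _≟_; z≤n; s≤s)
open import Data.Nat.Properties
open import Data.List using (List; []; _∷_; _++_; map; filter; length; upTo)
open import Data.List.Properties using (length-map; map-cong; ∷-injectiveʳ; map-cong-local; map-∘; map-id-local; length-upTo; map-upTo; ∷-injective; filter-accept; filter-reject; filter-none; filter-all; filter-++; ++-assoc; map-++; length-++; upTo-∷ʳ)
open import Data.List.Membership.Propositional using (_∈_; _∉_)
open import Data.List.Membership.Propositional.Properties using (∈-map⁻; ∈-upTo⁻; ∈-++⁺ʳ)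
open import Data.List.Relation.Unary.All as All using (All; []; _∷_)
open import Data.List.Relation.Unary.All.Properties using () renaming (++⁻ʳ to All-++⁻ʳ; map⁺ to All-map⁺)
open import Data.List.Relation.Unary.Any using (here; there)
open import Data.List.Relation.Unary.AllPairs as AllPairs using (AllPairs; []; _∷_)
import Data.List.Relation.Unary.AllPairs.Properties as AllPairs
open import Data.List.Relation.Unary.Unique.Propositional using (Unique)
import Data.List.Relation.Unary.Unique.Propositional.Properties as Unique
open import Data.List.Relation.Binary.Permutation.Propositional using (_↭_; module PermutationReasoning; ↭-refl; ↭-sym; ↭-trans; ↭-reflexive; ↭-prep; ↭-swap; ↭⇒↭ₛ)
open import Data.List.Relation.Binary.Permutation.Propositional.Properties using (All-resp-↭; ∈-resp-↭; ↭-length; filter-↭; shift; ∷↭∷ʳ; ++⁺ʳ) renaming (map⁺ to ↭-map⁺)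
open import Data.List.Relation.Binary.Permutation.Setoid.Properties using (Unique-resp-↭)
open import Data.List.Relation.Binary.Sublist.Propositional using (_⊆_; []; _∷_; _∷ʳ_; ⊆-refl; ⊆-trans; lookup; minimum)
open import Data.List.Relation.Binary.Sublist.Propositional.Properties using (length-mono-≤; ++⁺ˡ; All-resp-⊆; filter-⊆) renaming (filter⁺ to ⊆-filter⁺)
open import Data.Product using (∃; _×_; _,_; proj₁; proj₂; map₁; map₂)
open import Function using (_∘_; _$_; id)
open import Function.Bundles using (_⇔_; mk⇔)
open import Data.Empty using (⊥-elim)
open import Relation.Nullary using (¬_; ¬?; Dec; yes; no)
open import Relation.Binary.PropositionalEquality
open import Relation.Binary.PropositionalEquality.Properties using (setoid)
open import Relation.Binary using (tri<; tri≈; tri>)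

private
  variable
    A B : Set


All≢⇒∉ : ∀ {x : A} {ys} → All (_≢ x) ys → x ∉ ys
All≢⇒∉ ys≢x x∈ys = All.lookup ys≢x x∈ys refl

∈-⊆ : ∀ {x : A} {t xs} → t ⊆ xs → x ∈ t → x ∈ xs
∈-⊆ = lookup

AllPairs-resp-⊆ : ∀ {R : A → A → Set} {t xs} → t ⊆ xs → AllPairs R xs → AllPairs R t
AllPairs-resp-⊆ [] [] = []
AllPairs-resp-⊆ (_ ∷ʳ τ) (_ ∷ rs) = AllPairs-resp-⊆ τ rs
AllPairs-resp-⊆ (refl ∷ τ) (r ∷ rs) = All-resp-⊆ τ r ∷ AllPairs-resp-⊆ τ rs

Unique-middle : ∀ (xs : List A) {x ys} → Unique (xs ++ x ∷ ys) → All (_≢ x) xs × All (_≢ x) ys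
Unique-middle [] (x≢ys ∷ _) = [] , All.map ≢-sym x≢ys
Unique-middle (z ∷ xs) {x} (z≢ ∷ unique) =
  z≢x ∷ proj₁ (Unique-middle xs unique) , proj₂ (Unique-middle xs unique)
  where
  z≢x : z ≢ x
  z≢x = All.lookup z≢ (∈-++⁺ʳ xs (here refl))

∷⊆-after : ∀ {x : A} {t} xs {ys} → All (_≢ x) xs → All (_≢ x) ys → x ∷ t ⊆ xs ++ x ∷ ys → t ⊆ ys
∷⊆-after [] _ _ (refl ∷ τ) = τ
∷⊆-after [] _ ys≢x (_ ∷ʳ τ) = ⊥-elim (All≢⇒∉ ys≢x (∈-⊆ τ (here refl)))
∷⊆-after (z ∷ xs) (z≢x ∷ _) _ (refl ∷ _) = ⊥-elim (z≢x refl)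
∷⊆-after (z ∷ xs) (_ ∷ xs≢x) ys≢x (_ ∷ʳ τ) = ∷⊆-after xs xs≢x ys≢x τ

∷ʳ⊆-before : ∀ {x : A} t xs {ys} → All (_≢ x) xs → All (_≢ x) ys →
  t ++ x ∷ [] ⊆ xs ++ x ∷ ys → t ⊆ xs
∷ʳ⊆-before [] xs _ _ _ = minimum xs
∷ʳ⊆-before (u ∷ t) [] _ ys≢x (_ ∷ʳ τ) =
  ⊥-elim (All≢⇒∉ ys≢x (∈-⊆ τ (∈-++⁺ʳ (u ∷ t) (here refl))))
∷ʳ⊆-before (u ∷ t) [] _ ys≢x (_ ∷ τ) =
  ⊥-elim (All≢⇒∉ ys≢x (∈-⊆ τ (∈-++⁺ʳ t (here refl))))
∷ʳ⊆-before (u ∷ t) (z ∷ xs) (_ ∷ xs≢x) ys≢x (_ ∷ʳ τ) =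
  z ∷ʳ ∷ʳ⊆-before (u ∷ t) xs xs≢x ys≢x τ
∷ʳ⊆-before (u ∷ t) (z ∷ xs) (_ ∷ xs≢x) ys≢x (u≡z ∷ τ) =
  u≡z ∷ ∷ʳ⊆-before t xs xs≢x ys≢x τ

⊆-map⁻ : ∀ (f : A → B) {t} s → t ⊆ map f s → ∃ λ t₀ → t₀ ⊆ s × t ≡ map f t₀
⊆-map⁻ f [] [] = [] , [] , refl
⊆-map⁻ f (x ∷ s) (_ ∷ʳ τ) with ⊆-map⁻ f s τ
... | t₀ , τ₀ , refl = t₀ , x ∷ʳ τ₀ , refl
⊆-map⁻ f (x ∷ s) (refl ∷ τ) with ⊆-map⁻ f s τ
... | t₀ , τ₀ , refl = x ∷ t₀ , refl ∷ τ₀ , refl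

++-cancel-length : ∀ (xs ys : List A) {zs ws} → length xs ≡ length ys →
  xs ++ zs ≡ ys ++ ws → xs ≡ ys × zs ≡ ws
++-cancel-length [] [] _ eq = refl , eq
++-cancel-length (x ∷ xs) (y ∷ ys) |xs|≡|ys| eq with ∷-injective eq
... | refl , eq′ = map₁ (cong (x ∷_)) (++-cancel-length xs ys (suc-injective |xs|≡|ys|) eq′)

split-length : ∀ a {b} (xs : List A) → length xs ≡ a + b →
  ∃ λ ys → ∃ λ zs → xs ≡ ys ++ zs × length ys ≡ a × length zs ≡ b
split-length zero xs |xs| = [] , xs , refl , refl , |xs|
split-length (suc a) (x ∷ xs) |xs| with split-length a xs (suc-injective |xs|)
... | ys , zs , refl , |ys| , |zs| = x ∷ ys , zs , refl , cong suc |ys| , |zs|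

map-id-local⁻ : ∀ (f : A → A) xs → map f xs ≡ xs → All (λ x → f x ≡ x) xs
map-id-local⁻ f [] _ = []
map-id-local⁻ f (x ∷ xs) eq = proj₁ (∷-injective eq) ∷ map-id-local⁻ f xs (proj₂ (∷-injective eq))

map-injectiveOn : ∀ {P : A → Set} (f : A → B) → (∀ {x y} → P x → P y → f x ≡ f y → x ≡ y) →
  ∀ {xs ys} → All P xs → All P ys → map f xs ≡ map f ys → xs ≡ ys
map-injectiveOn f inj [] [] _ = refl
map-injectiveOn f inj (px ∷ pxs) (py ∷ pys) eq =
  cong₂ _∷_ (inj px py (proj₁ (∷-injective eq))) (map-injectiveOn f inj pxs pys (proj₂ (∷-injective eq)))

-- Permutations of 1 ‥ n

range : ℕ → List ℕ
range n = map suc (upTo n)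

range-suc : ∀ n → range (suc n) ≡ 1 ∷ map suc (range n)
range-suc n = cong (λ xs → 1 ∷ map suc xs) (sym (map-upTo suc n))

length-range : ∀ n → length (range n) ≡ n
length-range n = trans (length-map suc (upTo n)) (length-upTo n)

range-sorted : ∀ n → AllPairs _<_ (range n)
range-sorted n rewrite map-upTo suc n = AllPairs.applyUpTo⁺₁ suc n (λ i<j _ → s≤s i<j)

IsPerm-Unique : ∀ {p} → IsPerm p → Unique p
IsPerm-Unique {p} p↭ =
  Unique-resp-↭ (setoid ℕ) (↭⇒↭ₛ (↭-sym p↭)) (Unique.map⁺ suc-injective (Unique.upTo⁺ (length p)))

IsPerm-∈ : ∀ {p x} → IsPerm p → x ∈ p → 1 ≤ x × x ≤ length p
IsPerm-∈ {p} p↭ x∈p with ∈-map⁻ suc (∈-resp-↭ p↭ x∈p)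
... | i , i∈upTo , refl = s≤s z≤n , ∈-upTo⁻ i∈upTo

IsPerm-↭ : ∀ {p p'} → IsPerm p → IsPerm p' → length p ≡ length p' → p ↭ p'
IsPerm-↭ p↭ p'↭ |p|≡|p'| = ↭-trans p↭ (subst (λ n → range n ↭ _) (sym |p|≡|p'|) (↭-sym p'↭))

-- Standardisation

below : ℕ → List ℕ → ℕ
below x s = length (filter (_<? x) s)

rank : List ℕ → ℕ → ℕ
rank s x = suc (below x s)

below-∷-< : ∀ {x y} s → y < x → below x (y ∷ s) ≡ suc (below x s)
below-∷-< s y<x = cong length (filter-accept (_<? _) y<x)

below-∷-≮ : ∀ {x y} s → ¬ y < x → below x (y ∷ s) ≡ below x s
below-∷-≮ s y≮x = cong length (filter-reject (_<? _) y≮x)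

below-mono : ∀ {x y} s → x ≤ y → below x s ≤ below y s
below-mono s x≤y =
  length-mono-≤ (⊆-filter⁺ (_<? _) (_<? _) (λ { refl z<x → <-≤-trans z<x x≤y }) (⊆-refl {x = s}))

below-strict : ∀ {x y} s → x < y → x ∈ s → below x s < below y s
below-strict (x ∷ s) x<y (here refl) =
  subst₂ _<_ (sym (below-∷-≮ s (<-irrefl refl))) (sym (below-∷-< s x<y)) (s≤s (below-mono s (<⇒≤ x<y)))
below-strict {x} {y} (z ∷ s) x<y (there x∈s) with z <? x | z <? y
... | yes z<x | yes z<y rewrite below-∷-< s z<x | below-∷-< s z<y = s≤s (below-strict s x<y x∈s)
... | yes z<x | no z≮y  = ⊥-elim (z≮y (<-trans z<x x<y))
... | no z≮x  | yes z<y rewrite below-∷-≮ s z≮x | below-∷-< s z<y = m≤n⇒m≤1+n (below-strict s x<y x∈s)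
... | no z≮x  | no z≮y  rewrite below-∷-≮ s z≮x | below-∷-≮ s z≮y = below-strict s x<y x∈s

rank-reflects-< : ∀ s {x y} → rank s x < rank s y → x < y
rank-reflects-< s {x} {y} rx<ry with x <? y
... | yes x<y = x<y
... | no x≮y  = ⊥-elim (<⇒≱ rx<ry (s≤s (below-mono s (≮⇒≥ x≮y))))

rank-injectiveOn : ∀ s {x y} → x ∈ s → y ∈ s → rank s x ≡ rank s y → x ≡ y
rank-injectiveOn s {x} {y} x∈s y∈s rx≡ry with <-cmp x y
... | tri< x<y _ _ = ⊥-elim (<-irrefl (suc-injective rx≡ry) (below-strict s x<y x∈s))
... | tri≈ _ x≡y _ = x≡y
... | tri> _ _ y<x = ⊥-elim (<-irrefl (sym (suc-injective rx≡ry)) (below-strict s y<x y∈s))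

rank-resp-↭ : ∀ {xs ys} → xs ↭ ys → ∀ x → rank xs x ≡ rank ys x
rank-resp-↭ xs↭ys x = cong suc (↭-length (filter-↭ (_<? x) xs↭ys))

st-↭ : ∀ {xs ys} → xs ↭ ys → st xs ≡ map (rank ys) xs
st-↭ {xs} xs↭ys = map-cong (rank-resp-↭ xs↭ys) xs

st-sorted : ∀ {ys} → AllPairs _<_ ys → st ys ≡ range (length ys)
st-sorted {[]} [] = refl
st-sorted {y ∷ ys} (y<ys ∷ sorted) = begin
    rank (y ∷ ys) y ∷ map (rank (y ∷ ys)) ys
  ≡⟨ cong₂ _∷_ (cong (suc ∘ length) (filter-none (_<? y) (<-irrefl refl ∷ All.map <⇒≯ y<ys)))
               (map-cong-local (All.map (λ y<z → cong suc (below-∷-< ys y<z)) y<ys)) ⟩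
    1 ∷ map (suc ∘ rank ys) ys
  ≡⟨ cong (1 ∷_) (map-∘ ys) ⟩
    1 ∷ map suc (st ys)
  ≡⟨ cong (λ xs → 1 ∷ map suc xs) (st-sorted sorted) ⟩
    1 ∷ map suc (range (length ys))
  ≡⟨ range-suc (length ys) ⟨
    range (suc (length ys)) ∎
  where open ≡-Reasoning

st-IsPerm : ∀ {p} → IsPerm p → st p ≡ p
st-IsPerm {p} p↭ = begin
    st p
  ≡⟨ st-↭ p↭ ⟩
    map (rank R) p
  ≡⟨ map-id-local (All-resp-↭ (↭-sym p↭) rank-fixes-R) ⟩
    p ∎
  where
  open ≡-Reasoning
  R : List ℕ
  R = range (length p)
  rank-fixes-R : All (λ x → rank R x ≡ x) R
  rank-fixes-R = map-id-local⁻ (rank R) R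
    (trans (st-sorted (range-sorted (length p))) (cong range (length-range (length p))))

IsPerm-st : ∀ {xs ys} → xs ↭ ys → AllPairs _<_ ys → IsPerm (st xs)
IsPerm-st {xs} {ys} xs↭ys sorted = subst (λ n → st xs ↭ range n) |ys|≡|st-xs|
    (↭-trans (↭-reflexive (st-↭ xs↭ys))
             (↭-trans (↭-map⁺ (rank ys) xs↭ys) (↭-reflexive (st-sorted sorted))))
  where
  |ys|≡|st-xs| : length ys ≡ length (st xs)
  |ys|≡|st-xs| = trans (sym (↭-length xs↭ys)) (sym (length-map _ xs))

st-injective-↭ : ∀ {xs ys} → xs ↭ ys → st xs ≡ st ys → xs ≡ ys
st-injective-↭ {xs} {ys} xs↭ys eq = map-injectiveOn (rank ys) (rank-injectiveOn ys)
  (All.tabulate (∈-resp-↭ xs↭ys)) (All.tabulate id) (trans (sym (st-↭ xs↭ys)) eq)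

strictMono-reflects-< : ∀ {f : ℕ → ℕ} → (∀ {x y} → x < y → f x < f y) → ∀ {x y} → f x < f y → x < y
strictMono-reflects-< {f} mono {x} {y} fx<fy with <-cmp x y
... | tri< x<y _ _ = x<y
... | tri≈ _ refl _ = ⊥-elim (<-irrefl refl fx<fy)
... | tri> _ _ y<x = ⊥-elim (<-asym fx<fy (mono y<x))

below-map : ∀ {f : ℕ → ℕ} → (∀ {x y} → x < y → f x < f y) → ∀ x s → below (f x) (map f s) ≡ below x s
below-map mono x [] = refl
below-map {f} mono x (z ∷ s) with z <? x
... | yes z<x = begin
    below (f x) (f z ∷ map f s)  ≡⟨ below-∷-< (map f s) (mono z<x) ⟩
    suc (below (f x) (map f s))  ≡⟨ cong suc (below-map mono x s) ⟩
    suc (below x s)              ≡⟨ below-∷-< s z<x ⟨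
    below x (z ∷ s)              ∎
  where open ≡-Reasoning
... | no z≮x = begin
    below (f x) (f z ∷ map f s)  ≡⟨ below-∷-≮ (map f s) (z≮x ∘ strictMono-reflects-< mono) ⟩
    below (f x) (map f s)        ≡⟨ below-map mono x s ⟩
    below x s                    ≡⟨ below-∷-≮ s z≮x ⟨
    below x (z ∷ s)              ∎
  where open ≡-Reasoning

st-map : ∀ {f : ℕ → ℕ} → (∀ {x y} → x < y → f x < f y) → ∀ s → st (map f s) ≡ st s
st-map mono s = trans (sym (map-∘ s)) (map-cong (λ x → cong suc (below-map mono x s)) s)

-- Copies of 1342 and 1432

data Occ1xy2 : List ℕ → Set where
  occ : ∀ {a b c d} → a < d → d < b → d < c → b ≢ c → Occ1xy2 (a ∷ b ∷ c ∷ d ∷ [])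

Contains1xy2 : List ℕ → Set
Contains1xy2 p = ∃ λ t → t ⊆ p × Occ1xy2 t

Contains-⊆ : ∀ {s p} → s ⊆ p → Contains1xy2 s → Contains1xy2 p
Contains-⊆ s⊆p (t , τ , o) = t , ⊆-trans τ s⊆p , o

Occ-map⁻ : ∀ {f : ℕ → ℕ} → (∀ {x y} → f x < f y → x < y) → ∀ t → Occ1xy2 (map f t) → Occ1xy2 t
Occ-map⁻ reflects (_ ∷ _ ∷ _ ∷ _ ∷ []) (occ a<d d<b d<c b≢c) =
  occ (reflects a<d) (reflects d<b) (reflects d<c) (b≢c ∘ cong _)
Occ-map⁻ reflects [] ()
Occ-map⁻ reflects (_ ∷ []) ()
Occ-map⁻ reflects (_ ∷ _ ∷ []) ()
Occ-map⁻ reflects (_ ∷ _ ∷ _ ∷ []) ()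
Occ-map⁻ reflects (_ ∷ _ ∷ _ ∷ _ ∷ _ ∷ _) ()

Contains-map⁻ : ∀ {f : ℕ → ℕ} → (∀ {x y} → f x < f y → x < y) →
  ∀ s → Contains1xy2 (map f s) → Contains1xy2 s
Contains-map⁻ {f} reflects s (t , τ , o) with ⊆-map⁻ f s τ
... | t₀ , τ₀ , refl = t₀ , τ₀ , Occ-map⁻ reflects t₀ o

Contains-st⁻ : ∀ s → Contains1xy2 (st s) → Contains1xy2 s
Contains-st⁻ s = Contains-map⁻ (rank-reflects-< s) s

at : List ℕ → List ℕ → List ℕ
at σ ys = map (λ i → nth i ys) σ

-- st (a d b c) = 1 2 3 4, read at positions 1 3 4 2.
st-1342 : ∀ {a b c d} → a < d → d < b → b < c → st (a ∷ b ∷ c ∷ d ∷ []) ≡ 1 ∷ 3 ∷ 4 ∷ 2 ∷ []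
st-1342 {a} {b} {c} {d} a<d d<b b<c =
  trans (st-↭ (↭-prep a (shift d (b ∷ c ∷ []) [])))
        (cong (at (1 ∷ 3 ∷ 4 ∷ 2 ∷ [])) (st-sorted sorted))
  where
  sorted : AllPairs _<_ (a ∷ d ∷ b ∷ c ∷ [])
  sorted = (a<d ∷ <-trans a<d d<b ∷ <-trans a<d (<-trans d<b b<c) ∷ [])
         ∷ (d<b ∷ <-trans d<b b<c ∷ []) ∷ (b<c ∷ []) ∷ [] ∷ []

st-1432 : ∀ {a b c d} → a < d → d < c → c < b → st (a ∷ b ∷ c ∷ d ∷ []) ≡ 1 ∷ 4 ∷ 3 ∷ 2 ∷ []
st-1432 {a} {b} {c} {d} a<d d<c c<b =
  trans (st-↭ (↭-prep a (↭-trans (shift d (b ∷ c ∷ []) []) (↭-prep d (↭-swap b c ↭-refl)))))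
        (cong (at (1 ∷ 4 ∷ 3 ∷ 2 ∷ [])) (st-sorted sorted))
  where
  sorted : AllPairs _<_ (a ∷ d ∷ c ∷ b ∷ [])
  sorted = (a<d ∷ <-trans a<d d<c ∷ <-trans a<d (<-trans d<c c<b) ∷ [])
         ∷ (d<c ∷ <-trans d<c c<b ∷ []) ∷ (c<b ∷ []) ∷ [] ∷ []

Occ⇒st∈B₀ : ∀ {t} → Occ1xy2 t → st t ∈ B₀
Occ⇒st∈B₀ (occ {b = b} {c} a<d d<b d<c b≢c) with <-cmp b c
... | tri< b<c _ _ = subst (_∈ B₀) (sym (st-1342 a<d d<b b<c)) (here refl)
... | tri≈ _ b≡c _ = ⊥-elim (b≢c b≡c)
... | tri> _ _ c<b = subst (_∈ B₀) (sym (st-1432 a<d d<c c<b)) (there (here refl))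

Occ-B₀ : ∀ {σ} → σ ∈ B₀ → Occ1xy2 σ
Occ-B₀ (here refl) = occ (s≤s (s≤s z≤n)) (s≤s (s≤s (s≤s z≤n))) (s≤s (s≤s (s≤s z≤n))) (λ ())
Occ-B₀ (there (here refl)) = occ (s≤s (s≤s z≤n)) (s≤s (s≤s (s≤s z≤n))) (s≤s (s≤s (s≤s z≤n))) (λ ())

Avoids⇒¬Contains1xy2 : ∀ {p} → Avoids B₀ p → ¬ Contains1xy2 p
Avoids⇒¬Contains1xy2 avoids (t , τ , o) = avoids (st t) (Occ⇒st∈B₀ o) (t , τ , refl)

¬Contains1xy2⇒Avoids : ∀ {p} → ¬ Contains1xy2 p → Avoids B₀ p
¬Contains1xy2⇒Avoids ¬c σ σ∈B₀ (t , τ , refl) =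
  ¬c (t , τ , Occ-map⁻ (rank-reflects-< t) t (Occ-B₀ σ∈B₀))

sorted-¬Contains1xy2 : ∀ {s} → AllPairs _<_ s → ¬ Contains1xy2 s
sorted-¬Contains1xy2 sorted (_ , τ , occ _ d<b _ _) with AllPairs-resp-⊆ τ sorted
... | _ ∷ (_ ∷ b<d ∷ []) ∷ _ = <-asym d<b b<d

2<x : ∀ {x} → 1 ≤ x → x ≢ 1 → x ≢ 2 → 2 < x
2<x {1} _ x≢1 _ = ⊥-elim (x≢1 refl)
2<x {2} _ _ x≢2 = ⊥-elim (x≢2 refl)
2<x {suc (suc (suc _))} _ _ _ = s≤s (s≤s (s≤s z≤n))

Occ1xy2-from-Unique : ∀ {x y} → 1 ≤ x → 1 ≤ y →
  Unique (1 ∷ x ∷ y ∷ 2 ∷ []) → Occ1xy2 (1 ∷ x ∷ y ∷ 2 ∷ [])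
Occ1xy2-from-Unique 1≤x 1≤y ((1≢x ∷ 1≢y ∷ _) ∷ (x≢y ∷ x≢2 ∷ []) ∷ (y≢2 ∷ []) ∷ [] ∷ []) =
  occ (s≤s (s≤s z≤n)) (2<x 1≤x (≢-sym 1≢x) x≢2) (2<x 1≤y (≢-sym 1≢y) y≢2) x≢y

-- Deleting the entry 2

≢2? : ∀ x → Dec (x ≢ 2)
≢2? x = ¬? (x ≟ 2)

without2 : List ℕ → List ℕ
without2 = filter ≢2?

without2-++ : ∀ {xs ys} → All (_≢ 2) xs → All (_≢ 2) ys → without2 (xs ++ 2 ∷ ys) ≡ xs ++ ys
without2-++ {xs} {ys} xs≢2 ys≢2 = begin
    without2 (xs ++ 2 ∷ ys)          ≡⟨ filter-++ ≢2? xs (2 ∷ ys) ⟩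
    without2 xs ++ without2 (2 ∷ ys) ≡⟨ cong (without2 xs ++_) (filter-reject ≢2? {2} {ys} (_$ refl)) ⟩
    without2 xs ++ without2 ys       ≡⟨ cong₂ _++_ (filter-all ≢2? xs≢2) (filter-all ≢2? ys≢2) ⟩
    xs ++ ys                         ∎
  where open ≡-Reasoning

⊆-without2 : ∀ {t p} → t ⊆ p → All (_≢ 2) t → t ⊆ without2 p
⊆-without2 τ t≢2 = subst (_⊆ _) (filter-all ≢2? t≢2) (⊆-filter⁺ ≢2? ≢2? (λ { refl → id }) τ)

module _ {l m r : List ℕ} (p↭ : IsPerm (l ++ 1 ∷ m ++ 2 ∷ r)) where

  private
    p : List ℕ
    p = l ++ 1 ∷ m ++ 2 ∷ r

    p≡lm++2∷r : p ≡ (l ++ 1 ∷ m) ++ 2 ∷ r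
    p≡lm++2∷r = sym (++-assoc l (1 ∷ m) (2 ∷ r))

    separated-by-1 : All (_≢ 1) l × All (_≢ 1) (m ++ 2 ∷ r)
    separated-by-1 = Unique-middle l (IsPerm-Unique p↭)

    separated-by-2 : All (_≢ 2) (l ++ 1 ∷ m) × All (_≢ 2) r
    separated-by-2 = Unique-middle (l ++ 1 ∷ m) (subst Unique p≡lm++2∷r (IsPerm-Unique p↭))

    m≢2 : All (_≢ 2) m
    m≢2 = All.tail (All-++⁻ʳ l (proj₁ separated-by-2))

  without2-deletes-2 : without2 p ≡ l ++ 1 ∷ m ++ r
  without2-deletes-2 = begin
      without2 p                  ≡⟨ cong without2 p≡lm++2∷r ⟩
      without2 ((l ++ 1 ∷ m) ++ 2 ∷ r) ≡⟨ without2-++ (proj₁ separated-by-2) (proj₂ separated-by-2) ⟩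
      (l ++ 1 ∷ m) ++ r           ≡⟨ ++-assoc l (1 ∷ m) r ⟩
      l ++ 1 ∷ m ++ r             ∎
    where open ≡-Reasoning

  1-instead-of-2 : ∀ {t} → 2 ∷ t ⊆ p → 1 ∷ t ⊆ p
  1-instead-of-2 τ = ++⁺ˡ l (refl ∷ ++⁺ˡ m (2 ∷ʳ τr))
    where
    τr : _ ⊆ r
    τr = ∷⊆-after (l ++ 1 ∷ m) (proj₁ separated-by-2) (proj₂ separated-by-2) (subst (_ ⊆_) p≡lm++2∷r τ)

  between-1-and-2 : ∀ t → 1 ∷ t ++ 2 ∷ [] ⊆ p → t ⊆ m
  between-1-and-2 t τ =
    ∷ʳ⊆-before t m m≢2 (proj₂ separated-by-2) (∷⊆-after l (proj₁ separated-by-1) (proj₂ separated-by-1) τ)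

no-occurrence-through-2 : ∀ {l m r} → IsPerm (l ++ 1 ∷ m ++ 2 ∷ r) → length m ≤ 1 →
  ¬ Contains1xy2 (without2 (l ++ 1 ∷ m ++ 2 ∷ r)) → ¬ Contains1xy2 (l ++ 1 ∷ m ++ 2 ∷ r)
no-occurrence-through-2 p↭ |m|≤1 ¬c (_ , τ , occ {a} {b} {c} {d} a<d d<b d<c b≢c)
  with IsPerm-∈ p↭ (∈-⊆ τ (here refl)) | b ≟ 2 | c ≟ 2 | a ≟ 2 | d ≟ 2
... | 1≤a , _ | yes refl | _        | _        | _        = <⇒≱ d<b (≤-trans (s≤s 1≤a) a<d)
... | 1≤a , _ | no _     | yes refl | _        | _        = <⇒≱ d<c (≤-trans (s≤s 1≤a) a<d)
... | _       | no b≢2   | no c≢2   | yes refl | _        =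
  ¬c (_ , ⊆-without2 (1-instead-of-2 p↭ τ) ((λ ()) ∷ b≢2 ∷ c≢2 ∷ ≢-sym (<⇒≢ a<d) ∷ []) ,
      occ (<-trans (s≤s (s≤s z≤n)) a<d) d<b d<c b≢c)
... | 1≤a , _ | no _     | no _     | no _     | yes refl =
  <⇒≱ (s≤s |m|≤1)
      (length-mono-≤ (between-1-and-2 p↭ (b ∷ c ∷ []) (subst (λ x → x ∷ b ∷ c ∷ 2 ∷ [] ⊆ _) a≡1 τ)))
  where
  a≡1 : a ≡ 1
  a≡1 = ≤-antisym (≤-pred a<d) 1≤a
... | _       | no b≢2   | no c≢2   | no a≢2   | no d≢2   =
  ¬c (_ , ⊆-without2 τ (a≢2 ∷ b≢2 ∷ c≢2 ∷ d≢2 ∷ []) , occ a<d d<b d<c b≢c)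

at-most-one-between-1-and-2 : ∀ l m r → IsPerm (l ++ 1 ∷ m ++ 2 ∷ r) →
  ¬ Contains1xy2 (l ++ 1 ∷ m ++ 2 ∷ r) → length m ≤ 1
at-most-one-between-1-and-2 l [] r _ _ = z≤n
at-most-one-between-1-and-2 l (_ ∷ []) r _ _ = s≤s z≤n
at-most-one-between-1-and-2 l (x ∷ y ∷ m) r p↭ ¬c =
  ⊥-elim (¬c (_ , τ , Occ1xy2-from-Unique (positive (here refl)) (positive (there (here refl)))
                                           (AllPairs-resp-⊆ τ (IsPerm-Unique p↭))))
  where
  τ : 1 ∷ x ∷ y ∷ 2 ∷ [] ⊆ l ++ 1 ∷ (x ∷ y ∷ m) ++ 2 ∷ r
  τ = ++⁺ˡ l (refl ∷ refl ∷ refl ∷ ++⁺ˡ m (refl ∷ minimum r))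
  positive : ∀ {z} → z ∈ x ∷ y ∷ 2 ∷ [] → 1 ≤ z
  positive z∈ = proj₁ (IsPerm-∈ p↭ (∈-⊆ τ (there z∈)))

Z₁₂ : ℕ → ℕ → ℕ → List ℕ → Set
Z₁₂ g₁ g₂ g₃ = Z B₀ (1 ∷ 2 ∷ []) (g₁ ∷ g₂ ∷ g₃ ∷ [])

Z₁ : ℕ → ℕ → List ℕ → Set
Z₁ g₁ g₂ = Z B₀ (1 ∷ []) (g₁ ∷ g₂ ∷ [])

Z₁₂-g₂≤1 : ∀ {g₁ g₂ g₃ p} → Z₁₂ g₁ g₂ g₃ p → g₂ ≤ 1
Z₁₂-g₂≤1 (p↭ , avoids , l , _ , refl , _ , m , r , refl , refl , _) =
  at-most-one-between-1-and-2 l m r p↭ (Avoids⇒¬Contains1xy2 avoids)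

length-Z₁₂ : ∀ {g₁ g₂ g₃ p} → Z₁₂ g₁ g₂ g₃ p → length p ≡ g₁ + suc (g₂ + suc g₃)
length-Z₁₂ (_ , _ , l , _ , refl , refl , m , r , refl , refl , refl) =
  trans (length-++ l) (cong (λ n → length l + suc n) (length-++ m))

Fits-st : ∀ l m → All (1 ≤_) (l ++ 1 ∷ m) → Fits (1 ∷ []) (length l ∷ length m ∷ []) (st (l ++ 1 ∷ m))
Fits-st l m positive = map (rank s) l , map (rank s) m , st-split , length-map _ l , length-map _ m
  where
  s : List ℕ
  s = l ++ 1 ∷ m
  rank-1 : rank s 1 ≡ 1
  rank-1 = cong (suc ∘ length) (filter-none (_<? 1) (All.map ≤⇒≯ positive))
  st-split : st s ≡ map (rank s) l ++ 1 ∷ map (rank s) m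
  st-split = trans (map-++ (rank s) l (1 ∷ m)) (cong (λ x → map (rank s) l ++ x ∷ map (rank s) m) rank-1)

removeEntry2-Z₁ : ∀ {g₁ g₂ g₃ p} → Z₁₂ g₁ g₂ g₃ p → Z₁ g₁ (g₂ + g₃) (removeEntry 2 p)
removeEntry2-Z₁ {p = p} (p↭ , avoids , l , _ , refl , refl , m , r , refl , refl , refl) =
  IsPerm-st (filter-↭ ≢2? p↭) (AllPairs.filter⁺ ≢2? (range-sorted (length p))) ,
  ¬Contains1xy2⇒Avoids (Avoids⇒¬Contains1xy2 avoids ∘ Contains-⊆ (filter-⊆ ≢2? p) ∘ Contains-st⁻ (without2 p)) ,
  subst (λ s → Fits (1 ∷ []) (length l ∷ length m + length r ∷ []) (st s)) (sym (without2-deletes-2 p↭)) fits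
  where
  positive : All (1 ≤_) (l ++ 1 ∷ m ++ r)
  positive = All-resp-⊆ (subst (_⊆ p) (without2-deletes-2 p↭) (filter-⊆ ≢2? p))
                        (All.tabulate (proj₁ ∘ IsPerm-∈ p↭))
  fits : Fits (1 ∷ []) (length l ∷ length m + length r ∷ []) (st (l ++ 1 ∷ m ++ r))
  fits = subst (λ n → Fits (1 ∷ []) (length l ∷ n ∷ []) (st (l ++ 1 ∷ m ++ r))) (length-++ m)
               (Fits-st l (m ++ r) positive)

removeEntry2-injective : ∀ {g₁ g₂ g₃ p p'} → Z₁₂ g₁ g₂ g₃ p → Z₁₂ g₁ g₂ g₃ p' →
  removeEntry 2 p ≡ removeEntry 2 p' → p ≡ p'
removeEntry2-injective p∈Z@(p↭ , _ , l , _ , refl , |l| , m , r , refl , |m| , _)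
                       p'∈Z@(p'↭ , _ , l' , _ , refl , |l'| , m' , r' , refl , |m'| , _) eq =
  cong₂ (λ xs ys → xs ++ 1 ∷ ys) (proj₁ l≡l')
        (cong₂ (λ xs ys → xs ++ 2 ∷ ys) (proj₁ m≡m') (proj₂ m≡m'))
  where
  p↭p' : l ++ 1 ∷ m ++ 2 ∷ r ↭ l' ++ 1 ∷ m' ++ 2 ∷ r'
  p↭p' = IsPerm-↭ p↭ p'↭ (trans (length-Z₁₂ p∈Z) (sym (length-Z₁₂ p'∈Z)))
  same-remainder : l ++ 1 ∷ m ++ r ≡ l' ++ 1 ∷ m' ++ r'
  same-remainder = begin
      l ++ 1 ∷ m ++ r                   ≡⟨ without2-deletes-2 p↭ ⟨
      without2 (l ++ 1 ∷ m ++ 2 ∷ r)    ≡⟨ st-injective-↭ (filter-↭ ≢2? p↭p') eq ⟩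
      without2 (l' ++ 1 ∷ m' ++ 2 ∷ r') ≡⟨ without2-deletes-2 p'↭ ⟩
      l' ++ 1 ∷ m' ++ r'                ∎
    where open ≡-Reasoning
  l≡l' : l ≡ l' × 1 ∷ m ++ r ≡ 1 ∷ m' ++ r'
  l≡l' = ++-cancel-length l l' (trans |l| (sym |l'|)) same-remainder
  m≡m' : m ≡ m' × r ≡ r'
  m≡m' = ++-cancel-length m m' (trans |m| (sym |m'|)) (∷-injectiveʳ (proj₂ l≡l'))

-- Reinserting the entry 2

skip2 : ℕ → ℕ
skip2 0 = 0
skip2 1 = 1
skip2 (suc (suc n)) = suc (suc (suc n))

skip2-strictMono : ∀ {x y} → x < y → skip2 x < skip2 y
skip2-strictMono {0} {1} _ = s≤s z≤n
skip2-strictMono {0} {suc (suc _)} _ = s≤s z≤n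
skip2-strictMono {1} {suc (suc _)} _ = s≤s (s≤s z≤n)
skip2-strictMono {suc (suc _)} {suc (suc _)} x<y = s≤s x<y
skip2-strictMono {1} {1} (s≤s ())
skip2-strictMono {suc (suc _)} {1} (s≤s ())

skip2≢2 : ∀ x → skip2 x ≢ 2
skip2≢2 0 ()
skip2≢2 1 ()
skip2≢2 (suc (suc _)) ()

skip2-all≢2 : ∀ xs → All (_≢ 2) (map skip2 xs)
skip2-all≢2 xs = All-map⁺ (All.universal skip2≢2 xs)

skip2-above-1 : ∀ n → map skip2 (map suc (range n)) ≡ map suc (map suc (range n))
skip2-above-1 n = begin
    map skip2 (map suc (map suc (upTo n)))  ≡⟨ map-∘ _ ⟨
    map (skip2 ∘ suc) (map suc (upTo n))    ≡⟨ map-∘ _ ⟨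
    map (suc ∘ suc ∘ suc) (upTo n)          ≡⟨ map-∘ _ ⟩
    map suc (map (suc ∘ suc) (upTo n))      ≡⟨ cong (map suc) (map-∘ _) ⟩
    map suc (map suc (map suc (upTo n)))    ∎
  where open ≡-Reasoning

skip2-range : ∀ n → 2 ∷ map skip2 (range (suc n)) ↭ range (suc (suc n))
skip2-range n = begin
    2 ∷ map skip2 (range (suc n))           ≡⟨ cong (λ xs → 2 ∷ map skip2 xs) (range-suc n) ⟩
    2 ∷ 1 ∷ map skip2 (map suc (range n))   ↭⟨ ↭-swap 2 1 ↭-refl ⟩
    1 ∷ 2 ∷ map skip2 (map suc (range n))   ≡⟨ cong (λ xs → 1 ∷ 2 ∷ xs) (skip2-above-1 n) ⟩
    1 ∷ map suc (1 ∷ map suc (range n))     ≡⟨ cong (λ xs → 1 ∷ map suc xs) (range-suc n) ⟨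
    1 ∷ map suc (range (suc n))             ≡⟨ range-suc (suc n) ⟨
    range (suc (suc n))                     ∎
  where open PermutationReasoning

reinsert2 : List ℕ → List ℕ → List ℕ → List ℕ
reinsert2 l m r = map skip2 l ++ 1 ∷ map skip2 m ++ 2 ∷ map skip2 r

module _ (l m r : List ℕ) where

  private
    s : List ℕ
    s = l ++ 1 ∷ m ++ r

    reinsert2-split : reinsert2 l m r ≡ map skip2 (l ++ 1 ∷ m) ++ 2 ∷ map skip2 r
    reinsert2-split = trans (sym (++-assoc (map skip2 l) (1 ∷ map skip2 m) (2 ∷ map skip2 r)))
                            (cong (_++ 2 ∷ map skip2 r) (sym (map-++ skip2 l (1 ∷ m))))

    map-skip2-join : map skip2 (l ++ 1 ∷ m) ++ map skip2 r ≡ map skip2 s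
    map-skip2-join = trans (sym (map-++ skip2 (l ++ 1 ∷ m) r)) (cong (map skip2) (++-assoc l (1 ∷ m) r))

  without2-reinsert2 : without2 (reinsert2 l m r) ≡ map skip2 s
  without2-reinsert2 = begin
      without2 (reinsert2 l m r)                         ≡⟨ cong without2 reinsert2-split ⟩
      without2 (map skip2 (l ++ 1 ∷ m) ++ 2 ∷ map skip2 r) ≡⟨ without2-++ (skip2-all≢2 _) (skip2-all≢2 r) ⟩
      map skip2 (l ++ 1 ∷ m) ++ map skip2 r              ≡⟨ map-skip2-join ⟩
      map skip2 s                                        ∎
    where open ≡-Reasoning

  reinsert2-IsPerm : IsPerm s → IsPerm (reinsert2 l m r)
  reinsert2-IsPerm s↭ = subst (λ n → reinsert2 l m r ↭ range n) (sym |p|) p↭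
    where
    k : ℕ
    k = length (l ++ m ++ r)
    |s| : length s ≡ suc k
    |s| = ↭-length (shift 1 l (m ++ r))
    p↭ : reinsert2 l m r ↭ range (suc (suc k))
    p↭ = begin
        reinsert2 l m r                                   ≡⟨ reinsert2-split ⟩
        map skip2 (l ++ 1 ∷ m) ++ 2 ∷ map skip2 r        ↭⟨ shift 2 (map skip2 (l ++ 1 ∷ m)) _ ⟩
        2 ∷ map skip2 (l ++ 1 ∷ m) ++ map skip2 r        ≡⟨ cong (2 ∷_) map-skip2-join ⟩
        2 ∷ map skip2 s                                   ↭⟨ ↭-prep 2 (↭-map⁺ skip2 s↭) ⟩
        2 ∷ map skip2 (range (length s))                  ≡⟨ cong (λ n → 2 ∷ map skip2 (range n)) |s| ⟩
        2 ∷ map skip2 (range (suc k))                     ↭⟨ skip2-range k ⟩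
        range (suc (suc k))                               ∎
      where open PermutationReasoning
    |p| : length (reinsert2 l m r) ≡ suc (suc k)
    |p| = trans (↭-length p↭) (length-range _)

  removeEntry2-reinsert2 : IsPerm s → removeEntry 2 (reinsert2 l m r) ≡ s
  removeEntry2-reinsert2 s↭ = begin
      st (without2 (reinsert2 l m r))  ≡⟨ cong st without2-reinsert2 ⟩
      st (map skip2 s)                 ≡⟨ st-map skip2-strictMono s ⟩
      st s                             ≡⟨ st-IsPerm s↭ ⟩
      s                                ∎
    where open ≡-Reasoning

  reinsert2-Avoids : IsPerm s → Avoids B₀ s → length m ≤ 1 → Avoids B₀ (reinsert2 l m r)
  reinsert2-Avoids s↭ avoids |m|≤1 = ¬Contains1xy2⇒Avoids
    (no-occurrence-through-2 (reinsert2-IsPerm s↭) (subst (_≤ 1) (sym (length-map skip2 m)) |m|≤1)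
      (Avoids⇒¬Contains1xy2 avoids ∘ Contains-map⁻ (strictMono-reflects-< skip2-strictMono) s
       ∘ subst Contains1xy2 without2-reinsert2))

removeEntry2-surjective : ∀ {g₁ g₂ g₃} → g₂ ≤ 1 → ∀ q → Z₁ g₁ (g₂ + g₃) q →
  ∃ λ p → Z₁₂ g₁ g₂ g₃ p × removeEntry 2 p ≡ q
removeEntry2-surjective {g₂ = g₂} g₂≤1 q (q↭ , avoids , l , r₀ , refl , refl , |r₀|)
  with split-length g₂ r₀ |r₀|
... | m , r , refl , refl , refl =
  reinsert2 l m r ,
  (reinsert2-IsPerm l m r q↭ , reinsert2-Avoids l m r q↭ avoids g₂≤1 ,
   map skip2 l , _ , refl , length-map skip2 l ,
   map skip2 m , map skip2 r , refl , length-map skip2 m , length-map skip2 r) ,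
  removeEntry2-reinsert2 l m r q↭

prependMax : List ℕ → List ℕ
prependMax q = suc (length q) ∷ q

prependMax-IsPerm : ∀ {q} → IsPerm q → IsPerm (prependMax q)
prependMax-IsPerm {q} q↭ = begin
    suc (length q) ∷ q                      ↭⟨ ∷↭∷ʳ _ q ⟩
    q ++ suc (length q) ∷ []                ↭⟨ ++⁺ʳ _ q↭ ⟩
    range (length q) ++ suc (length q) ∷ [] ≡⟨ map-++ suc (upTo (length q)) _ ⟨
    map suc (upTo (length q) ++ length q ∷ []) ≡⟨ cong (map suc) (upTo-∷ʳ (length q)) ⟩
    range (suc (length q))                  ∎
  where open PermutationReasoning

prependMax-¬Contains1xy2 : ∀ {q} → IsPerm q → ¬ Contains1xy2 q → ¬ Contains1xy2 (prependMax q)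
prependMax-¬Contains1xy2 q↭ ¬c (t , _ ∷ʳ τ , o) = ¬c (t , τ , o)
prependMax-¬Contains1xy2 q↭ ¬c (_ , refl ∷ τ , occ a<d _ _ _) =
  <⇒≱ a<d (m≤n⇒m≤1+n (proj₂ (IsPerm-∈ q↭ (∈-⊆ τ (there (there (here refl)))))))

-- (n + g₁ + 1) ⋯ (n + 2) 1 2 ⋯ (n + 1)
Z₁-witness : ℕ → ℕ → List ℕ
Z₁-witness zero n = range (suc n)
Z₁-witness (suc g₁) n = prependMax (Z₁-witness g₁ n)

Z₁-witness-∈Z₁ : ∀ g₁ n → Z₁ g₁ n (Z₁-witness g₁ n)
Z₁-witness-∈Z₁ zero n =
  ↭-reflexive (cong range (sym (length-range (suc n)))) ,
  ¬Contains1xy2⇒Avoids (sorted-¬Contains1xy2 (range-sorted (suc n))) ,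
  [] , map suc (range n) , range-suc n , refl , trans (length-map suc (range n)) (length-range n)
Z₁-witness-∈Z₁ (suc g₁) n with Z₁-witness-∈Z₁ g₁ n
... | q↭ , avoids , l , r , q≡ , |l| , |r| =
  prependMax-IsPerm q↭ ,
  ¬Contains1xy2⇒Avoids (prependMax-¬Contains1xy2 q↭ (Avoids⇒¬Contains1xy2 avoids)) ,
  _ ∷ l , r , cong (suc (length (Z₁-witness g₁ n)) ∷_) q≡ , cong suc |l| , |r|

Z₁₂-inhabited : ∀ {g₁ g₂ g₃} → g₂ ≤ 1 → Nonempty (Z₁₂ g₁ g₂ g₃)
Z₁₂-inhabited {g₁} {g₂} {g₃} g₂≤1 =
  map₂ proj₁ (removeEntry2-surjective g₂≤1 _ (Z₁-witness-∈Z₁ g₁ (g₂ + g₃)))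

mainTheorem1 : ((g₁ g₂ g₃ : ℕ) → Nonempty (Z B₀ (1 ∷ 2 ∷ []) (g₁ ∷ g₂ ∷ g₃ ∷ [])) ⇔ (g₂ ≤ 1))
      × ESPlusReducible B₀ (1 ∷ 2 ∷ []) 2
mainTheorem1 = (λ _ _ _ → mk⇔ (Z₁₂-g₂≤1 ∘ proj₂) Z₁₂-inhabited) , entry2-reducible
  where
  entry2-reducible : ESPlusReducible B₀ (1 ∷ 2 ∷ []) 2
  entry2-reducible (g₁ ∷ g₂ ∷ g₃ ∷ []) _ (_ , p∈Z) =
    (λ _ → removeEntry2-Z₁) , (λ _ _ → removeEntry2-injective) , removeEntry2-surjective (Z₁₂-g₂≤1 p∈Z)
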